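{- Let $\lambda$ and $k$ be positive integers, let $\mathcal F$ be a $k$-MOFS$(2\lambda)$ and let $(X_1,\dots,X_{k+2})$ be a full relation on $\mathcal F$. Then $|X_1|\equiv|X_2|\equiv\lambda k\pmod 2$.
   Context: Let $N(n)=\{1,\dots,n\}$ and let $n$ be even. A (binary) frequency square of order $n$ is an $n\times n$ array indexed by $N(n)\times N(n)$ with entries in $\{0,1\}$ such that every row and every column contains exactly $n/2$ zeros and $n/2$ ones. Two frequency squares $F,G$ of order $n$ are orthogonal if for each $(a,b)\in\{0,1\}^2$ the number of cells $(r,c)$ with $(F[r,c],G[r,c])=(a,b)$ equals $n^2/4$. A $k$-MOFS$(n)$ is an ordered set $F_1,\dots,F_k$ of pairwise orthogonal frequency squares of order $n$. Relations: form the $n^2\times(k+2)$ array $\mathcal O$ having a row $(i,j,F_1[i,j],\dots,F_k[i,j])$ for each $(i,j)\in N(n)^2$. Let $Y_1=Y_2=N(n)$ and $Y_c=\{0,1\}$ for $3\le c\le k+2$. A relation is a tuple $(X_1,\dots,X_{k+2})$ with $X_c\subseteq Y_c$ for all $c$ such that every row of $\mathcal O$ has an even number of positions $c$ for which the $c$-th entry of the row lies in $X_c$. A relation is trivial on column $c$ if $X_c=\emptyset$ or $X_c=Y_c$; it is full if it is non-trivial on every column $c\in\{1,\dots,k+2\}$ except possibly one of the columns $1,2$. -}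

module Defs where

open import Data.Nat using (ℕ; zero; suc; _+_; _*_; _%_)
open import Data.Bool using (Bool; true; false; if_then_else_; _∧_)
open import Data.Fin using (Fin; zero; suc; _≟_)
open import Data.Fin.Subset using (Subset; Nonempty; ∁)
open import Data.Vec using (lookup)
open import Data.Product using (_×_)
open import Data.Sum using (_⊎_)
open import Relation.Binary.PropositionalEquality using (_≡_; _≢_)
open import Relation.Nullary.Decidable using (⌊_⌋)

Sym : Set
Sym = Fin 2

count : ∀ {n} → (Fin n → Bool) → ℕ
count {zero}  p = 0
count {suc n} p = (if p zero then 1 else 0) + count (λ i → p (suc i))

sumFin : ∀ {n} → (Fin n → ℕ) → ℕ
sumFin {zero}  f = 0
sumFin {suc n} f = f zero + sumFin (λ i → f (suc i))

Square : ℕ → Set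
Square n = Fin n → Fin n → Sym

IsFrequencySquare : (m : ℕ) → Square (2 * m) → Set
IsFrequencySquare m F =
  (∀ (r : Fin (2 * m)) (a : Sym) → count (λ c → ⌊ F r c ≟ a ⌋) ≡ m) ×
  (∀ (c : Fin (2 * m)) (a : Sym) → count (λ r → ⌊ F r c ≟ a ⌋) ≡ m)

pairCount : ∀ {n} → Square n → Square n → Sym → Sym → ℕ
pairCount F G a b = sumFin (λ r → count (λ c → ⌊ F r c ≟ a ⌋ ∧ ⌊ G r c ≟ b ⌋))

-- orthogonality for order n = 2 * m: each pair occurs n²/4 = m * m times
Orthogonal : (m : ℕ) → Square (2 * m) → Square (2 * m) → Set
Orthogonal m F G = ∀ (a b : Sym) → pairCount F G a b ≡ m * m

IsMOFS : (m k : ℕ) → (Fin k → Square (2 * m)) → Set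
IsMOFS m k Fs =
  (∀ (i : Fin k) → IsFrequencySquare m (Fs i)) ×
  (∀ (i j : Fin k) → i ≢ j → Orthogonal m (Fs i) (Fs j))

_∈ᵇ_ : ∀ {n} → Fin n → Subset n → Bool
x ∈ᵇ X = lookup X x

-- number of entries of the row (r, c, F_1[r,c], ..., F_k[r,c]) of O that lie in
-- the corresponding X's
rowHits : ∀ {n k} → (Fin k → Square n) →
          Subset n → Subset n → (Fin k → Subset 2) → Fin n → Fin n → ℕ
rowHits Fs X₁ X₂ Xs r c =
  (if r ∈ᵇ X₁ then 1 else 0) + (if c ∈ᵇ X₂ then 1 else 0) +
  count (λ t → Fs t r c ∈ᵇ Xs t)

-- relation (X_1, X_2, X_3..X_{k+2}) on the array O; Xs t plays the role of X_{t+3}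
IsRelation : ∀ {n k} → (Fin k → Square n) →
             Subset n → Subset n → (Fin k → Subset 2) → Set
IsRelation Fs X₁ X₂ Xs = ∀ r c → rowHits Fs X₁ X₂ Xs r c % 2 ≡ 0

NonTrivial : ∀ {n} → Subset n → Set
NonTrivial X = Nonempty X × Nonempty (∁ X)

IsFull : ∀ {n k} → Subset n → Subset n → (Fin k → Subset 2) → Set
IsFull X₁ X₂ Xs = (∀ t → NonTrivial (Xs t)) × (NonTrivial X₁ ⊎ NonTrivial X₂)

-- Sum the relation condition down a single column c. Every row contributes an
-- even number of hits. Column 1 contributes |X₁| hits, column 2 contributes
-- 2λ or 0 (the entry c is the same in every row), and column t + 2 contributes
-- exactly λ: a non-trivial subset of {0,1} is a single symbol, and a frequency
-- square has that symbol λ times in column c. Hence |X₁| + λk is even. Summing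
-- along a row instead gives the claim for X₂.
module Submission where

open import Defs
open import Data.Nat using (ℕ; zero; suc; _+_; _*_; _%_; _>_)
open import Data.Nat.Properties using (+-comm; *-comm; +-0-commutativeMonoid)
open import Data.Nat.Divisibility using (_∣_; _∣0; m%n≡0⇒n∣m; ∣m∣n⇒∣m+n; ∣m+n∣m⇒∣n; ∣m⇒∣m*n; m∣m*n)
open import Data.Nat.DivMod using ([m+kn]%n≡m%n; %-remove-+ˡ)
open import Data.Nat.Tactic.RingSolver using (solve-∀)
open import Data.Bool using (Bool; true; false; if_then_else_)
open import Data.Fin using (Fin; zero; suc; _≟_)
open import Data.Fin.Subset using (Subset; ∣_∣)
open import Data.Vec using ([]; _∷_; there)
open import Data.Product using (_×_; _,_; ∃; proj₁; proj₂)
open import Relation.Binary.PropositionalEquality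
  using (_≡_; refl; sym; trans; cong; cong₂; subst; module ≡-Reasoning)
open import Relation.Nullary.Decidable using (⌊_⌋)
open import Algebra.Properties.CommutativeMonoid.Sum +-0-commutativeMonoid
  using (sum; sum-cong-≗; ∑-distrib-+; ∑-comm)

open ≡-Reasoning

indicator : Bool → ℕ
indicator b = if b then 1 else 0

count≡sum : ∀ {n} (p : Fin n → Bool) → count p ≡ sum (λ i → indicator (p i))
count≡sum {zero}  p = refl
count≡sum {suc n} p = cong (indicator (p zero) +_) (count≡sum (λ i → p (suc i)))

count-cong : ∀ {n} {p q : Fin n → Bool} → (∀ i → p i ≡ q i) → count p ≡ count q
count-cong {zero}  p≗q = refl
count-cong {suc n} p≗q = cong₂ _+_ (cong indicator (p≗q zero)) (count-cong (λ i → p≗q (suc i)))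

sum-const : ∀ n x → sum {n} (λ _ → x) ≡ n * x
sum-const zero    x = refl
sum-const (suc n) x = cong (x +_) (sum-const n x)

∣sum : ∀ {d n} (f : Fin n → ℕ) → (∀ i → d ∣ f i) → d ∣ sum f
∣sum {d} {zero}  f d∣f = d ∣0
∣sum {d} {suc n} f d∣f = ∣m∣n⇒∣m+n (d∣f zero) (∣sum (λ i → f (suc i)) (λ i → d∣f (suc i)))

2∣m+n⇒m%2≡n%2 : ∀ m n → 2 ∣ m + n → m % 2 ≡ n % 2
2∣m+n⇒m%2≡n%2 m n 2∣m+n = begin
  m % 2           ≡⟨ sym ([m+kn]%n≡m%n m n 2) ⟩
  (m + n * 2) % 2 ≡⟨ cong (_% 2) (regroup m n) ⟩
  (m + n + n) % 2 ≡⟨ %-remove-+ˡ n 2∣m+n ⟩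
  n % 2           ∎
  where
  regroup : ∀ m n → m + n * 2 ≡ m + n + n
  regroup = solve-∀

∣∣≡count : ∀ {n} (X : Subset n) → ∣ X ∣ ≡ count (_∈ᵇ X)
∣∣≡count []          = refl
∣∣≡count (true ∷ X)  = cong suc (∣∣≡count X)
∣∣≡count (false ∷ X) = ∣∣≡count X

nonTrivial⇒singleton : (S : Subset 2) → NonTrivial S → ∃ λ a → ∀ s → s ∈ᵇ S ≡ ⌊ s ≟ a ⌋
nonTrivial⇒singleton (true ∷ false ∷ [])  _ = zero , λ { zero → refl ; (suc zero) → refl }
nonTrivial⇒singleton (false ∷ true ∷ [])  _ = suc zero , λ { zero → refl ; (suc zero) → refl }
nonTrivial⇒singleton (true ∷ true ∷ [])   (_ , zero , ())
nonTrivial⇒singleton (true ∷ true ∷ [])   (_ , suc zero , there ())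
nonTrivial⇒singleton (false ∷ false ∷ []) ((zero , ()) , _)
nonTrivial⇒singleton (false ∷ false ∷ []) ((suc zero , there ()) , _)

Balanced : ∀ {n} → ℕ → (Fin n → Sym) → Set
Balanced m L = ∀ a → count (λ i → ⌊ L i ≟ a ⌋) ≡ m

count-∈-balanced : ∀ {n m} (L : Fin n → Sym) (S : Subset 2) → NonTrivial S → Balanced m L →
                   count (λ i → L i ∈ᵇ S) ≡ m
count-∈-balanced {m = m} L S nt balanced with nonTrivial⇒singleton S nt
... | a , S≡⁅a⁆ = begin
  count (λ i → L i ∈ᵇ S)        ≡⟨ count-cong (λ i → S≡⁅a⁆ (L i)) ⟩
  count (λ i → ⌊ L i ≟ a ⌋)     ≡⟨ balanced a ⟩
  m                             ∎

sum-count-∈-balanced : ∀ {n m k} (Ls : Fin k → Fin n → Sym) (Ss : Fin k → Subset 2) →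
  (∀ t → NonTrivial (Ss t)) → (∀ t → Balanced m (Ls t)) →
  sum (λ i → count (λ t → Ls t i ∈ᵇ Ss t)) ≡ k * m
sum-count-∈-balanced {m = m} {k} Ls Ss nt balanced = begin
  sum (λ i → count (λ t → Ls t i ∈ᵇ Ss t))
    ≡⟨ sum-cong-≗ (λ i → count≡sum (λ t → Ls t i ∈ᵇ Ss t)) ⟩
  sum (λ i → sum (λ t → indicator (Ls t i ∈ᵇ Ss t)))
    ≡⟨ ∑-comm (λ i t → indicator (Ls t i ∈ᵇ Ss t)) ⟩
  sum (λ t → sum (λ i → indicator (Ls t i ∈ᵇ Ss t)))
    ≡⟨ sum-cong-≗ (λ t → sym (count≡sum (λ i → Ls t i ∈ᵇ Ss t))) ⟩
  sum (λ t → count (λ i → Ls t i ∈ᵇ Ss t))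
    ≡⟨ sum-cong-≗ (λ t → count-∈-balanced (Ls t) (Ss t) (nt t) (balanced t)) ⟩
  sum {k} (λ _ → m)
    ≡⟨ sum-const k m ⟩
  k * m ∎

-- The relation condition along one column (or row) of the array: U is X₁ (or X₂)
-- on that line, and w is the fixed hit of the column (row) index in X₂ (or X₁).
line-parity : ∀ {m k} (U : Fin (2 * m) → Bool) (w : ℕ)
  (Ls : Fin k → Fin (2 * m) → Sym) (Ss : Fin k → Subset 2) →
  (∀ t → NonTrivial (Ss t)) → (∀ t → Balanced m (Ls t)) →
  (∀ i → (indicator (U i) + w + count (λ t → Ls t i ∈ᵇ Ss t)) % 2 ≡ 0) →
  count U % 2 ≡ (m * k) % 2
line-parity {m} {k} U w Ls Ss nt balanced even = begin
  count U % 2   ≡⟨ 2∣m+n⇒m%2≡n%2 (count U) (k * m) 2∣count+km ⟩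
  (k * m) % 2   ≡⟨ cong (_% 2) (*-comm k m) ⟩
  (m * k) % 2   ∎
  where
  hits : Fin (2 * m) → ℕ
  hits i = count (λ t → Ls t i ∈ᵇ Ss t)

  regroup : ∀ a b c → a + b + c ≡ b + (a + c)
  regroup = solve-∀

  total : sum (λ i → indicator (U i) + w + hits i) ≡ 2 * m * w + (count U + k * m)
  total = begin
    sum (λ i → indicator (U i) + w + hits i)
      ≡⟨ ∑-distrib-+ (λ i → indicator (U i) + w) hits ⟩
    sum (λ i → indicator (U i) + w) + sum hits
      ≡⟨ cong (_+ sum hits) (∑-distrib-+ (λ i → indicator (U i)) (λ _ → w)) ⟩
    sum (λ i → indicator (U i)) + sum {2 * m} (λ _ → w) + sum hits
      ≡⟨ cong₂ (λ x y → x + y + sum hits) (sym (count≡sum U)) (sum-const (2 * m) w) ⟩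
    count U + 2 * m * w + sum hits
      ≡⟨ cong (count U + 2 * m * w +_) (sum-count-∈-balanced Ls Ss nt balanced) ⟩
    count U + 2 * m * w + k * m
      ≡⟨ regroup (count U) (2 * m * w) (k * m) ⟩
    2 * m * w + (count U + k * m) ∎

  2∣total : 2 ∣ 2 * m * w + (count U + k * m)
  2∣total = subst (2 ∣_) total (∣sum _ (λ i → m%n≡0⇒n∣m _ 2 (even i)))

  2∣count+km : 2 ∣ count U + k * m
  2∣count+km = ∣m+n∣m⇒∣n 2∣total (∣m⇒∣m*n w (m∣m*n m))

lemma2p2 : (λ' k : ℕ) → λ' > 0 → k > 0 →
    (Fs : Fin k → Square (2 * λ')) → IsMOFS λ' k Fs →
    (X₁ X₂ : Subset (2 * λ')) (Xs : Fin k → Subset 2) →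
    IsRelation Fs X₁ X₂ Xs → IsFull X₁ X₂ Xs →
    (∣ X₁ ∣ % 2 ≡ (λ' * k) % 2) × (∣ X₂ ∣ % 2 ≡ (λ' * k) % 2)
lemma2p2 λ'@(suc _) k _ _ Fs (freq , _) X₁ X₂ Xs rel (nt , _) = parity₁ , parity₂
  where
  line₀ : Fin (2 * λ')
  line₀ = zero

  parity₁ : ∣ X₁ ∣ % 2 ≡ (λ' * k) % 2
  parity₁ rewrite ∣∣≡count X₁ =
    line-parity (_∈ᵇ X₁) (indicator (line₀ ∈ᵇ X₂)) (λ t r → Fs t r line₀) Xs nt
      (λ t → proj₂ (freq t) line₀) (λ r → rel r line₀)

  parity₂ : ∣ X₂ ∣ % 2 ≡ (λ' * k) % 2
  parity₂ rewrite ∣∣≡count X₂ =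
    line-parity (_∈ᵇ X₂) (indicator (line₀ ∈ᵇ X₁)) (λ t c → Fs t line₀ c) Xs nt
      (λ t → proj₁ (freq t) line₀)
      (λ c → trans (cong (λ x → (x + count (λ t → Fs t line₀ c ∈ᵇ Xs t)) % 2)
                          (+-comm (indicator (c ∈ᵇ X₂)) (indicator (line₀ ∈ᵇ X₁))))
                   (rel line₀ c))
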